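{- Fix one of the four contortion classes (cartesian, disjunctive, Dedekind, De Morgan) for forming Kan cells. Let $\langle X\mid R\rangle$ be a convenient presentation of a group $G$. For any pair of words $v,w$ on $X$ with $v\equiv_G w$, there exists a Kan cell $t$ over the dimension context $(i,k)$ in the cell context $\Gamma_{X,R}$ with boundary $[\,i=0\mapsto\star,\ i=1\mapsto\star,\ k=0\mapsto\ulcorner v\urcorner(i),\ k=1\mapsto\ulcorner w\urcorner(i)\,]$.
   Context: Dimension contexts and terms: a dimension context $\Psi$ is a finite list of distinct dimension variables or the inconsistent context $\bot$. Dimension terms over $\Psi$ are elements of the free De Morgan algebra on its variables (generated by variables, $0,1,\sim,\vee,\wedge$); over $\bot$ all terms are equal. Atomic (cartesian) terms are variables, $0,1$; disjunctive terms use only variables, $0,1,\vee$; Dedekind terms use only variables, $0,1,\vee,\wedge$; De Morgan terms are arbitrary. A contortion $\psi:\Psi'\to\Psi$, $\Psi=(i_1,\dots,i_n)$, is a tuple of dimension terms over $\Psi'$ (unique from $\bot$ to $\bot$, none from $\Psi'\neq\bot$ to $\bot$), belonging to a class if all its terms do; a substitution is a contortion with atomic terms. For atomic $r$ and endpoint $e\in\{0,1\}$, $\Psi|_{r=e}$ is $\Psi$ with $i$ removed if $r=i$, $\bot$ if $r$ is the endpoint opposite to $e$, and $\Psi$ if $r=e$, with the constraining substitution $\Psi|_{r=e}\to\Psi$ sending $r$ to $e$. Cells: a cell context is a list of declarations $a:\Psi_a[\varphi_a]$ with $\varphi_a$ a boundary over $\Psi_a$ in the preceding declarations. A boundary over $\Psi$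 (possibly with extra variables $\Psi'$) is a list of entries $(r=e\mapsto t)$, $r$ atomic over $\Psi$, $t$ a cell over $\Psi|_{r=e},\Psi'$, mutually agreeing on overlaps. A contorted cell over $\Psi$ is $a(\psi)$ with $a:\Psi_a[\varphi_a]$ declared and $\psi:\Psi\to\Psi_a$ a contortion of the fixed class; $a(\psi)=t[\psi]$ whenever $(r=e\mapsto t)\in\varphi_a$ and $r[\psi]=e[\psi]$; all cells over $\bot$ are equal. A cell $t$ has boundary $\varphi$ if its restriction along each constraining substitution $\Psi|_{r=e}\to\Psi$ equals the corresponding entry. Kan cells over $\Psi$: every contorted cell is a Kan cell; and if $e$ is an endpoint, $r$ atomic over $\Psi$, $\varphi$ a Kan boundary over $\Psi$ with one extra variable $j$, and $u$ a Kan cell over $\Psi$ with boundary $\varphi[j\mapsto e]$, then $\mathsf{fill}^{e\to r}_j[\varphi](u)$ is a Kan cell over $\Psi$ with boundary $\varphi[j\mapsto r]$ together with the entry $(r=e\mapsto u)$. Encoding: given a convenient presentation $\langle X\mid R\rangle$ (finite generator set $X$ closed under inverses, every relation of the form $abc^{ -1}=1$ with $a,b,c\in X$), the cell context $\Gamma_{X,R}$ consists of a point $\star:()$ with empty boundary; for each $a\in X$ a loop $\hat a:(i)[i=0\mapsto\star,\ i=1\mapsto\star]$; for each relation $abc^{ -1}=1$ in $R$ a square $s_{a,b,c}:(j,k)[k=0\mapsto\hat a(j),\ k=1\mapsto\hat c(j),\ j=0\mapsto\star,\ j=1\mapsto\hat b(k)]$. For a Kan cell $t$ over $(i)$ with boundary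 $[i=0\mapsto\star, i=1\mapsto\star]$, $a\in X$ and endpoint $e$, put $t\rhd^e_i a:=\mathsf{fill}^{\bar e\to e}_j[\,i=0\mapsto\star,\ i=1\mapsto\hat a(j)\,](t)$, where $\bar e$ is the endpoint opposite to $e$. For a word $w$ on $X$ define $\ulcorner w\urcorner(i)$ recursively: $\ulcorner\epsilon\urcorner(i)=\star$ (the point viewed as a cell over $(i)$), $\ulcorner wa\urcorner(i)=\ulcorner w\urcorner(i)\rhd^1_i a$, $\ulcorner wa^{ -1}\urcorner(i)=\ulcorner w\urcorner(i)\rhd^0_i a$. $v\equiv_G w$ means the words $v,w$ represent the same element of $G$. -}

module Defs where

open import Data.Nat using (ℕ; zero; suc)
open import Data.Fin using (Fin; zero; suc; punchIn; punchOut)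
open import Data.Fin.Properties using (_≟_)
open import Data.Bool using (Bool; true; false; not)
open import Data.List using (List; []; _∷_; _++_; map; foldl)
open import Data.List.Relation.Unary.All using (All)
open import Data.List.Relation.Binary.Pointwise using (Pointwise)
open import Data.List.Membership.Propositional using (_∈_)
open import Data.Product using (Σ; _×_; _,_; ∃; proj₁; proj₂)
open import Data.Unit using (⊤; tt)
open import Data.Empty using (⊥)
open import Relation.Nullary using (yes; no)

-- Conventions
--  * A (consistent) dimension context with n variables is  ctx n ;
--    its variables are the positions  Fin n  (names are irrelevant).
--    The inconsistent context is  ⊥ctx .
--  * Extra (bound) variables of a boundary, e.g. the variable j of a
--    fill, are PREPENDED: a cell over  Ψ, j  lives over  ext Ψ  and
--    j is the position  zero .
--  * Endpoints are Booleans: false = 0, true = 1.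

data Ctx : Set where
  ctx  : ℕ → Ctx
  ⊥ctx : Ctx

ext : Ctx → Ctx
ext (ctx n) = ctx (suc n)
ext ⊥ctx    = ⊥ctx

_⊕_ : Ctx → ℕ → Ctx
Γ ⊕ zero  = Γ
Γ ⊕ suc p = ext (Γ ⊕ p)

-- Dimension terms: syntax of the free De Morgan algebra on n generators

infixr 6 _∧_
infixr 5 _∨_
data DTm (n : ℕ) : Set where
  var     : Fin n → DTm n
  𝟎 𝟏     : DTm n
  ~_      : DTm n → DTm n
  _∨_ _∧_ : DTm n → DTm n → DTm n

end : ∀ {n} → Bool → DTm n
end false = 𝟎
end true  = 𝟏

infix 4 _≐_
data _≐_ {n : ℕ} : DTm n → DTm n → Set where
  ≐-refl  : ∀ {x} → x ≐ x
  ≐-sym   : ∀ {x y} → x ≐ y → y ≐ x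
  ≐-trans : ∀ {x y z} → x ≐ y → y ≐ z → x ≐ z
  ~-cong  : ∀ {x x'} → x ≐ x' → ~ x ≐ ~ x'
  ∨-cong  : ∀ {x x' y y'} → x ≐ x' → y ≐ y' → x ∨ y ≐ x' ∨ y'
  ∧-cong  : ∀ {x x' y y'} → x ≐ x' → y ≐ y' → x ∧ y ≐ x' ∧ y'
  ∨-assoc : ∀ x y z → (x ∨ y) ∨ z ≐ x ∨ (y ∨ z)
  ∧-assoc : ∀ x y z → (x ∧ y) ∧ z ≐ x ∧ (y ∧ z)
  ∨-comm  : ∀ x y → x ∨ y ≐ y ∨ x
  ∧-comm  : ∀ x y → x ∧ y ≐ y ∧ x
  ∨-absorbs-∧ : ∀ x y → x ∨ (x ∧ y) ≐ x
  ∧-absorbs-∨ : ∀ x y → x ∧ (x ∨ y) ≐ x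
  ∧-distrib-∨ : ∀ x y z → x ∧ (y ∨ z) ≐ (x ∧ y) ∨ (x ∧ z)
  ∨-identity  : ∀ x → x ∨ 𝟎 ≐ x
  ∧-identity  : ∀ x → x ∧ 𝟏 ≐ x
  ~-invol     : ∀ x → ~ (~ x) ≐ x
  ~-deMorgan  : ∀ x y → ~ (x ∨ y) ≐ (~ x) ∧ (~ y)

data Class : Set where
  cartesian disjunctive dedekind deMorgan : Class

IsAtomic : ∀ {n} → DTm n → Set
IsAtomic (var _) = ⊤
IsAtomic 𝟎 = ⊤
IsAtomic 𝟏 = ⊤
IsAtomic _ = ⊥

IsDisjunctive : ∀ {n} → DTm n → Set
IsDisjunctive (var _) = ⊤
IsDisjunctive 𝟎 = ⊤
IsDisjunctive 𝟏 = ⊤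
IsDisjunctive (x ∨ y) = IsDisjunctive x × IsDisjunctive y
IsDisjunctive _ = ⊥

IsDedekind : ∀ {n} → DTm n → Set
IsDedekind (var _) = ⊤
IsDedekind 𝟎 = ⊤
IsDedekind 𝟏 = ⊤
IsDedekind (x ∨ y) = IsDedekind x × IsDedekind y
IsDedekind (x ∧ y) = IsDedekind x × IsDedekind y
IsDedekind (~ _) = ⊥

InClass : Class → ∀ {n} → DTm n → Set
InClass cartesian   t = IsAtomic t
InClass disjunctive t = IsDisjunctive t
InClass dedekind    t = IsDedekind t
InClass deMorgan    t = ⊤

data Atom (n : ℕ) : Set where
  avar : Fin n → Atom n
  aend : Bool → Atom n

atomTm : ∀ {n} → Atom n → DTm n
atomTm (avar x) = var x
atomTm (aend e) = end e

-- a substitution Ψ' → Ψ (Ψ' = ctx m, Ψ = ctx n): an atom over Ψ' for each variable of Ψ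
Subst : ℕ → ℕ → Set
Subst m n = Fin n → Atom m

atomSub : ∀ {m n} → Subst m n → Atom n → Atom m
atomSub σ (avar x) = σ x
atomSub σ (aend e) = aend e

dsub : ∀ {m n} → Subst m n → DTm n → DTm m
dsub σ (var x) = atomTm (σ x)
dsub σ 𝟎 = 𝟎
dsub σ 𝟏 = 𝟏
dsub σ (~ x) = ~ dsub σ x
dsub σ (x ∨ y) = dsub σ x ∨ dsub σ y
dsub σ (x ∧ y) = dsub σ x ∧ dsub σ y

CSub : Ctx → Ctx → Set
CSub ⊥ctx   _       = ⊤
CSub (ctx m) (ctx n) = Subst m n
CSub (ctx m) ⊥ctx    = ⊥

AtomC : Ctx → Set
AtomC ⊥ctx    = ⊤
AtomC (ctx m) = Atom m

atomSubC : ∀ {Γ n} → CSub Γ (ctx n) → Atom n → AtomC Γ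
atomSubC {⊥ctx}  σ r = tt
atomSubC {ctx m} σ r = atomSub σ r

wkAtom : ∀ {m} → Atom m → Atom (suc m)
wkAtom (avar x) = avar (suc x)
wkAtom (aend e) = aend e

lift : ∀ {m n} → Subst m n → Subst (suc m) (suc n)
lift σ zero    = avar zero
lift σ (suc x) = wkAtom (σ x)

liftC : ∀ {Γ Δ} → CSub Γ Δ → CSub (ext Γ) (ext Δ)
liftC {⊥ctx}            σ = tt
liftC {ctx m} {ctx n}   σ = lift σ
liftC {ctx m} {⊥ctx}    ()

liftsC : ∀ {Γ Δ} (p : ℕ) → CSub Γ Δ → CSub (Γ ⊕ p) (Δ ⊕ p)
liftsC zero    σ = σ
liftsC (suc p) σ = liftC (liftsC p σ)

ifEq : Bool → Bool → Ctx → Ctx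
ifEq false false Γ = Γ
ifEq true  true  Γ = Γ
ifEq false true  Γ = ⊥ctx
ifEq true  false Γ = ⊥ctx

restrict : (n : ℕ) → Atom n → Bool → Ctx
restrict n       (aend b)  e = ifEq b e (ctx n)
restrict (suc n) (avar i)  e = ctx n
restrict zero    (avar ()) e

restrictC : (Γ : Ctx) → AtomC Γ → Bool → Ctx
restrictC ⊥ctx    r e = ⊥ctx
restrictC (ctx m) r e = restrict m r e

dropAt : ∀ {n} → Fin (suc n) → Bool → Subst n (suc n)
dropAt i e x with i ≟ x
... | yes _  = aend e
... | no i≢x = avar (punchOut i≢x)

constr : ∀ {n} (r : Atom n) (e : Bool) → CSub (restrict n r e) (ctx n)
constr (aend false) false = avar
constr (aend true)  true  = avar
constr (aend false) true  = tt
constr (aend true)  false = tt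
constr {suc n} (avar i)  e = dropAt i e
constr {zero}  (avar ()) e

constrC : (Γ : Ctx) (r : AtomC Γ) (e : Bool) → CSub (restrictC Γ r e) Γ
constrC ⊥ctx    r e = tt
constrC (ctx m) r e = constr r e

restrictSub : ∀ {Γ n} (σ : CSub Γ (ctx n)) (r : Atom n) (e : Bool)
            → CSub (restrictC Γ (atomSubC σ r) e) (restrict n r e)
restrictSub {⊥ctx}  σ r e = tt
restrictSub {ctx m} σ (aend false) false = σ
restrictSub {ctx m} σ (aend true)  true  = σ
restrictSub {ctx m} σ (aend false) true  = tt
restrictSub {ctx m} σ (aend true)  false = tt
restrictSub {ctx m} {zero} σ (avar ()) e
restrictSub {ctx zero} {suc n} σ (avar i) e with σ i
... | aend false with e
...   | false = λ x → σ (punchIn i x)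
...   | true  = tt
restrictSub {ctx zero} {suc n} σ (avar i) e | aend true with e
...   | false = tt
...   | true  = λ x → σ (punchIn i x)
restrictSub {ctx (suc m)} {suc n} σ (avar i) e with σ i
... | avar i' = λ x → atomSub (dropAt i' e) (σ (punchIn i x))
... | aend false with e
...   | false = λ x → σ (punchIn i x)
...   | true  = tt
restrictSub {ctx (suc m)} {suc n} σ (avar i) e | aend true with e
...   | false = tt
...   | true  = λ x → σ (punchIn i x)

instSub : (R : Ctx) → AtomC R → CSub R (ext R)
instSub ⊥ctx    a = tt
instSub (ctx m) a = λ { zero → a ; (suc x) → avar x }

-- Convenient presentations: X = Fin N, relations  rel ρ = (a , b , c)
-- standing for  a b c⁻¹ = 1.

Rel : ℕ → ℕ → Set
Rel N M = Fin M → Fin N × Fin N × Fin N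

relA relB relC : ∀ {N M} → Rel N M → Fin M → Fin N
relA rel ρ = proj₁ (rel ρ)
relB rel ρ = proj₁ (proj₂ (rel ρ))
relC rel ρ = proj₂ (proj₂ (rel ρ))

-- words on X: letters (a , true) = a and (a , false) = a⁻¹
Word : ℕ → Set
Word N = List (Fin N × Bool)

module Group {N M : ℕ} (rel : Rel N M) where

  infix 4 _≡G_
  data _≡G_ : Word N → Word N → Set where
    G-refl  : ∀ {v} → v ≡G v
    G-sym   : ∀ {v w} → v ≡G w → w ≡G v
    G-trans : ∀ {u v w} → u ≡G v → v ≡G w → u ≡G w
    G-free  : ∀ u w a s → (u ++ (a , s) ∷ (a , not s) ∷ w) ≡G (u ++ w)
    G-rel   : ∀ u w ρ →
      (u ++ (relA rel ρ , true) ∷ (relB rel ρ , true) ∷ (relC rel ρ , false) ∷ w) ≡G (u ++ w)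

  ClosedUnderInverses : Set
  ClosedUnderInverses = ∀ a → ∃ λ b → ((a , true) ∷ (b , true) ∷ []) ≡G []

module Cells (cls : Class) {N M : ℕ} (rel : Rel N M) where

  mutual
    data Tm (n : ℕ) : Set where
      pt   : Tm n
      lp   : Fin N → DTm n → Tm n
      sq   : Fin M → DTm n → DTm n → Tm n
      fill : Bool → Atom n → List (Entry n 1) → Tm n → Tm n
      -- fill e r φ u  =  fill^{e→r}_j [φ] (u)

    record Entry (n p : ℕ) : Set where
      inductive
      constructor _≔_↦_
      field
        atom : Atom n
        endp : Bool
        cell : CellsC (restrict n atom endp ⊕ p)

    CellsC : Ctx → Set
    CellsC ⊥ctx    = ⊤
    CellsC (ctx m) = Tm m

  mutual
    subTm : ∀ {m n} → Subst m n → Tm n → Tm m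
    subTm σ pt = pt
    subTm σ (lp a ψ) = lp a (dsub σ ψ)
    subTm σ (sq ρ ψ χ) = sq ρ (dsub σ ψ) (dsub σ χ)
    subTm σ (fill e r φ u) = fill e (atomSub σ r) (subEntries σ φ) (subTm σ u)

    subEntries : ∀ {m n p} → Subst m n → List (Entry n p) → List (Entry m p)
    subEntries σ [] = []
    subEntries σ (x ∷ φ) = subEntry σ x ∷ subEntries σ φ

    subEntry : ∀ {m n p} → Subst m n → Entry n p → Entry m p
    subEntry {m} {n} {p} σ (r ≔ e ↦ t) =
      atomSub σ r ≔ e ↦ cellSub (liftsC p (restrictSub {ctx m} σ r e)) t

    cellSub : ∀ {Γ Δ} → CSub Γ Δ → CellsC Δ → CellsC Γ
    cellSub {⊥ctx}          σ t = tt
    cellSub {ctx m} {ctx n} σ t = subTm σ t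
    cellSub {ctx m} {⊥ctx}  () t

  instJ : ∀ {n} → Atom n → Entry n 1 → Entry n 0
  instJ {n} a (r ≔ e ↦ t) =
    r ≔ e ↦ cellSub (instSub (restrict n r e) (atomSubC (constr r e) a)) t

  inst : ∀ {n} → Atom n → Subst n (suc n)
  inst a zero    = a
  inst a (suc x) = avar x

  infix 4 _≈_
  mutual
    data _≈_ {n : ℕ} : Tm n → Tm n → Set where
      ≈-refl  : ∀ {t} → t ≈ t
      ≈-sym   : ∀ {t u} → t ≈ u → u ≈ t
      ≈-trans : ∀ {t u v} → t ≈ u → u ≈ v → t ≈ v
      lp-cong : ∀ {a ψ ψ'} → ψ ≐ ψ' → lp a ψ ≈ lp a ψ'
      sq-cong : ∀ {ρ ψ ψ' χ χ'} → ψ ≐ ψ' → χ ≐ χ' → sq ρ ψ χ ≈ sq ρ ψ' χ'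
      fill-cong : ∀ {e r φ φ' u u'} → Pointwise _≈E_ φ φ' → u ≈ u' →
                  fill e r φ u ≈ fill e r φ' u'
      -- a(ψ) = t[ψ] when (r = e ↦ t) ∈ φ_a and r[ψ] = e[ψ]
      lp-i0 : ∀ {a ψ} → ψ ≐ 𝟎 → lp a ψ ≈ pt
      lp-i1 : ∀ {a ψ} → ψ ≐ 𝟏 → lp a ψ ≈ pt
      sq-k0 : ∀ {ρ ψ χ} → χ ≐ 𝟎 → sq ρ ψ χ ≈ lp (relA rel ρ) ψ
      sq-k1 : ∀ {ρ ψ χ} → χ ≐ 𝟏 → sq ρ ψ χ ≈ lp (relC rel ρ) ψ
      sq-j0 : ∀ {ρ ψ χ} → ψ ≐ 𝟎 → sq ρ ψ χ ≈ pt
      sq-j1 : ∀ {ρ ψ χ} → ψ ≐ 𝟏 → sq ρ ψ χ ≈ lp (relB rel ρ) χ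
      -- a Kan fill has boundary (r = e ↦ u) and φ[j ↦ r]
      fill-src : ∀ {e φ u} → IsKan (fill e (aend e) φ u) → fill e (aend e) φ u ≈ u
      fill-bd0 : ∀ {e r φ u t} → IsKan (fill e r φ u) →
                 (aend false ≔ false ↦ t) ∈ φ → fill e r φ u ≈ subTm (inst r) t
      fill-bd1 : ∀ {e r φ u t} → IsKan (fill e r φ u) →
                 (aend true ≔ true ↦ t) ∈ φ → fill e r φ u ≈ subTm (inst r) t

    data _≈E_ {n p : ℕ} : Entry n p → Entry n p → Set where
      ent-≈ : ∀ {r e t t'} → EqC (restrict n r e ⊕ p) t t' → (r ≔ e ↦ t) ≈E (r ≔ e ↦ t')

    EqC : (Γ : Ctx) → CellsC Γ → CellsC Γ → Set
    EqC ⊥ctx    t u = ⊤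
    EqC (ctx m) t u = t ≈ u

    data IsKan {n : ℕ} : Tm n → Set where
      pt-kan   : IsKan pt
      lp-kan   : ∀ {a ψ} → InClass cls ψ → IsKan (lp a ψ)
      sq-kan   : ∀ {ρ ψ χ} → InClass cls ψ → InClass cls χ → IsKan (sq ρ ψ χ)
      fill-kan : ∀ {e r φ u} → KanBdry φ → IsKan u → HasBdry u (map (instJ (aend e)) φ) →
                 IsKan (fill e r φ u)

    IsKanC : (Γ : Ctx) → CellsC Γ → Set
    IsKanC ⊥ctx    t = ⊤
    IsKanC (ctx m) t = IsKan t

    KanEntry : ∀ {n p} → Entry n p → Set
    KanEntry {n} {p} (r ≔ e ↦ t) = IsKanC (restrict n r e ⊕ p) t

    -- two entries agree on their overlap Ψ|_{r₁=e₁}|_{r₂=e₂}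
    Agree : ∀ {n p} → Entry n p → Entry n p → Set
    Agree {n} {p} (r₁ ≔ e₁ ↦ t₁) (r₂ ≔ e₂ ↦ t₂) =
      EqC (restrictC (restrict n r₁ e₁) (atomSubC (constr r₁ e₁) r₂) e₂ ⊕ p)
          (cellSub (liftsC p (constrC (restrict n r₁ e₁) (atomSubC (constr r₁ e₁) r₂) e₂)) t₁)
          (cellSub (liftsC p (restrictSub (constr r₁ e₁) r₂ e₂)) t₂)

    KanBdry : ∀ {n p} → List (Entry n p) → Set
    KanBdry φ = All KanEntry φ × All (λ x → All (Agree x) φ) φ

    BdEntry : ∀ {n} → Tm n → Entry n 0 → Set
    BdEntry {n} t (r ≔ e ↦ c) = EqC (restrict n r e) (cellSub (constr r e) t) c

    HasBdry : ∀ {n} → Tm n → List (Entry n 0) → Set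
    HasBdry t φ = All (BdEntry t) φ

  _▷[_]_ : Tm 1 → Bool → Fin N → Tm 1
  t ▷[ e ] a = fill (not e) (aend e)
    ((avar zero ≔ false ↦ pt) ∷ (avar zero ≔ true ↦ lp a (var zero)) ∷ []) t

  ⌜_⌝ : Word N → Tm 1
  ⌜ w ⌝ = foldl (λ t l → t ▷[ proj₂ l ] proj₁ l) pt w

{-# OPTIONS --safe #-}
module Submission where

-- Write v ∼ w (Homotopy v w) when some Kan square has the loops ⌜v⌝ and ⌜w⌝ as its two sides in
-- the first direction and ⋆ as its other two sides. Every step is a box: the two-dimensional Kan
-- filling of four Kan squares standing on a base square, whose lid is again such a square. Boxes
-- show that ∼ is an equivalence relation and is preserved by appending a letter. Standing the
-- fillers of ⌜u⌝ ▷ a^s and ⌜u a^s⌝ ▷ a^-s side by side on the constant square of ⌜u a^s⌝ gives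
-- u ∼ u a^s a^-s; standing the fillers of ⌜u⌝ ▷ a and ⌜u a b⌝ ▷ c⁻¹ on the filler of ⌜u a⌝ ▷ b,
-- with the relation square s_{a,b,c} as a wall, gives u ∼ u a b c⁻¹. So ∼ contains ≡G, and a
-- last box transposes the square into the orientation of the statement.
--
-- Closure of Kan cells under substitution is not part of IsKan, so the invariant carried through
-- the boxes (KanSquare) also asks that all faces and corners be Kan, with ⋆ at the corners: the
-- faces of a box are one-dimensional fillings (SideFill), their ends zero-dimensional ones
-- (cornerFill), and the Kan-ness of each has to be checked by hand.

open import Defs
open import Data.Nat using (ℕ; zero; suc)
open import Data.Fin using (Fin; zero; suc; punchIn)
open import Data.Fin.Properties using (_≟_; punchInᵢ≢i; punchOut-punchIn; punchOut-cong)
open import Data.Bool using (Bool; true; false; not; if_then_else_)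
open import Data.List using (List; []; _∷_; _++_; _∷ʳ_; foldl)
open import Data.List.Properties using (foldl-++; ++-assoc; ++-identityʳ)
open import Data.List.Relation.Unary.All using (All; []; _∷_)
import Data.List.Relation.Unary.All as All
open import Data.List.Relation.Unary.All.Properties using (++⁺; map⁺)
open import Data.List.Relation.Unary.Any using (here; there)
open import Data.List.Relation.Binary.Subset.Propositional using (_⊆_)
open import Data.List.Relation.Binary.Subset.Propositional.Properties using (xs⊆xs++ys; xs⊆ys++xs)
open import Data.Product using (Σ; _×_; _,_; proj₁; proj₂; uncurry)
open import Data.Unit using (⊤; tt)
open import Data.Empty using (⊥-elim)
open import Function using (_∘_)
open import Relation.Nullary using (yes; no)
open import Relation.Binary.PropositionalEquality

dropAt-self : ∀ {n} (i : Fin (suc n)) e → dropAt i e i ≡ aend e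
dropAt-self i e with i ≟ i
... | yes _  = refl
... | no i≢i = ⊥-elim (i≢i refl)

dropAt-punchIn : ∀ {n} (i : Fin (suc n)) e x → dropAt i e (punchIn i x) ≡ avar x
dropAt-punchIn i e x with i ≟ punchIn i x
... | yes i≡i+x = ⊥-elim (punchInᵢ≢i i x (sym i≡i+x))
... | no  _     = cong avar (trans (punchOut-cong i refl) (punchOut-punchIn i))

InClass-var : ∀ cls {n} (x : Fin n) → InClass cls (var x)
InClass-var cartesian   x = tt
InClass-var disjunctive x = tt
InClass-var dedekind    x = tt
InClass-var deMorgan    x = tt

InClass-end : ∀ cls {n} e → InClass cls (end {n} e)
InClass-end cartesian   false = tt
InClass-end cartesian   true  = tt
InClass-end disjunctive false = tt
InClass-end disjunctive true  = tt
InClass-end dedekind    false = tt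
InClass-end dedekind    true  = tt
InClass-end deMorgan    e     = tt

module KanSquares (cls : Class) {N M : ℕ} (rel : Rel N M) where
  open Cells cls rel

  infix 4 _≗C_
  _≗C_ : ∀ {Γ Δ} → CSub Γ Δ → CSub Γ Δ → Set
  _≗C_ {ctx m} {ctx n} σ τ = σ ≗ τ
  _≗C_ {ctx m} {⊥ctx}  σ τ = ⊤
  _≗C_ {⊥ctx}          σ τ = ⊤

  atomSub-cong : ∀ {m n} {σ τ : Subst m n} → σ ≗ τ → ∀ r → atomSub σ r ≡ atomSub τ r
  atomSub-cong σ≗τ (avar x) = σ≗τ x
  atomSub-cong σ≗τ (aend e) = refl

  dsub-cong : ∀ {m n} {σ τ : Subst m n} → σ ≗ τ → ∀ ψ → dsub σ ψ ≡ dsub τ ψ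
  dsub-cong σ≗τ (var x) = cong atomTm (σ≗τ x)
  dsub-cong σ≗τ 𝟎       = refl
  dsub-cong σ≗τ 𝟏       = refl
  dsub-cong σ≗τ (~ ψ)   = cong ~_ (dsub-cong σ≗τ ψ)
  dsub-cong σ≗τ (ψ ∨ χ) = cong₂ _∨_ (dsub-cong σ≗τ ψ) (dsub-cong σ≗τ χ)
  dsub-cong σ≗τ (ψ ∧ χ) = cong₂ _∧_ (dsub-cong σ≗τ ψ) (dsub-cong σ≗τ χ)

  liftsC-cong : ∀ {Γ Δ} p {σ τ : CSub Γ Δ} → σ ≗C τ → liftsC p σ ≗C liftsC p τ
  liftsC-cong zero    σ≗τ = σ≗τ
  liftsC-cong (suc p) σ≗τ = liftC-cong (liftsC-cong p σ≗τ)
    where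
    liftC-cong : ∀ {Γ Δ} {σ τ : CSub Γ Δ} → σ ≗C τ → liftC σ ≗C liftC τ
    liftC-cong {ctx m} {ctx n} σ≗τ zero    = refl
    liftC-cong {ctx m} {ctx n} σ≗τ (suc x) = cong wkAtom (σ≗τ x)
    liftC-cong {ctx m} {⊥ctx} {()}
    liftC-cong {⊥ctx}          σ≗τ = tt

  -- The clauses for avar follow those of restrictSub, which only computes once σ i is known.
  mutual
    subTm-cong : ∀ {m n} {σ τ : Subst m n} → σ ≗ τ → ∀ t → subTm σ t ≡ subTm τ t
    subTm-cong σ≗τ pt             = refl
    subTm-cong σ≗τ (lp a ψ)       = cong (lp a) (dsub-cong σ≗τ ψ)
    subTm-cong σ≗τ (sq ρ ψ χ)     = cong₂ (sq ρ) (dsub-cong σ≗τ ψ) (dsub-cong σ≗τ χ)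
    subTm-cong σ≗τ (fill e r φ u) =
      cong₂ (λ (r , φ) → fill e r φ) (cong₂ _,_ (atomSub-cong σ≗τ r) (subEntries-cong σ≗τ φ)) (subTm-cong σ≗τ u)

    subEntries-cong : ∀ {m n p} {σ τ : Subst m n} → σ ≗ τ → (φ : List (Entry n p))
                    → subEntries σ φ ≡ subEntries τ φ
    subEntries-cong σ≗τ []      = refl
    subEntries-cong σ≗τ (E ∷ φ) = cong₂ _∷_ (subEntry-cong σ≗τ E) (subEntries-cong σ≗τ φ)

    subEntry-cong : ∀ {m n p} {σ τ : Subst m n} → σ ≗ τ → (E : Entry n p) → subEntry σ E ≡ subEntry τ E
    subEntry-cong {p = p} σ≗τ (aend false ≔ false ↦ c) =
      cong (aend false ≔ false ↦_) (cellSub-cong (liftsC-cong p σ≗τ) c)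
    subEntry-cong {p = p} σ≗τ (aend true  ≔ true  ↦ c) =
      cong (aend true ≔ true ↦_) (cellSub-cong (liftsC-cong p σ≗τ) c)
    subEntry-cong         σ≗τ (aend false ≔ true  ↦ c) = refl
    subEntry-cong         σ≗τ (aend true  ≔ false ↦ c) = refl
    subEntry-cong {suc m} {suc n} {p} {σ} {τ} σ≗τ (avar i ≔ e ↦ c) with σ i | τ i | σ≗τ i
    ... | avar i' | _ | refl =
      cong (avar i' ≔ e ↦_) (cellSub-cong (liftsC-cong {ctx m} p λ x → cong (atomSub (dropAt i' e)) (σ≗τ (punchIn i x))) c)
    subEntry-cong {suc m} {suc n} {p} σ≗τ (avar i ≔ false ↦ c) | aend false | _ | refl =
      cong (aend false ≔ false ↦_) (cellSub-cong (liftsC-cong {ctx (suc m)} p (σ≗τ ∘ punchIn i)) c)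
    subEntry-cong {suc m} {suc n} {p} σ≗τ (avar i ≔ true  ↦ c) | aend true  | _ | refl =
      cong (aend true ≔ true ↦_) (cellSub-cong (liftsC-cong {ctx (suc m)} p (σ≗τ ∘ punchIn i)) c)
    subEntry-cong {suc m} {suc n} σ≗τ (avar i ≔ true  ↦ c) | aend false | _ | refl = refl
    subEntry-cong {suc m} {suc n} σ≗τ (avar i ≔ false ↦ c) | aend true  | _ | refl = refl
    subEntry-cong {zero}  {suc n} {p} {σ} {τ} σ≗τ (avar i ≔ e ↦ c) with σ i | τ i | σ≗τ i
    subEntry-cong {zero}  {suc n} {p} σ≗τ (avar i ≔ false ↦ c) | aend false | _ | refl =
      cong (aend false ≔ false ↦_) (cellSub-cong (liftsC-cong {ctx zero} p (σ≗τ ∘ punchIn i)) c)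
    subEntry-cong {zero}  {suc n} {p} σ≗τ (avar i ≔ true  ↦ c) | aend true  | _ | refl =
      cong (aend true ≔ true ↦_) (cellSub-cong (liftsC-cong {ctx zero} p (σ≗τ ∘ punchIn i)) c)
    subEntry-cong {zero}  {suc n} σ≗τ (avar i ≔ true  ↦ c) | aend false | _ | refl = refl
    subEntry-cong {zero}  {suc n} σ≗τ (avar i ≔ false ↦ c) | aend true  | _ | refl = refl

    cellSub-cong : ∀ {Γ Δ} {σ τ : CSub Γ Δ} → σ ≗C τ → (c : CellsC Δ) → cellSub σ c ≡ cellSub τ c
    cellSub-cong {ctx m} {ctx n} σ≗τ c = subTm-cong σ≗τ c
    cellSub-cong {ctx m} {⊥ctx} {()}
    cellSub-cong {⊥ctx}          σ≗τ c = refl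

  IsIdC : ∀ {Γ} → CSub Γ Γ → Set
  IsIdC {ctx m} σ = σ ≗ avar
  IsIdC {⊥ctx}  σ = ⊤

  dsub-id : ∀ {n} {σ : Subst n n} → σ ≗ avar → ∀ ψ → dsub σ ψ ≡ ψ
  dsub-id σ≗id (var x) = cong atomTm (σ≗id x)
  dsub-id σ≗id 𝟎       = refl
  dsub-id σ≗id 𝟏       = refl
  dsub-id σ≗id (~ ψ)   = cong ~_ (dsub-id σ≗id ψ)
  dsub-id σ≗id (ψ ∨ χ) = cong₂ _∨_ (dsub-id σ≗id ψ) (dsub-id σ≗id χ)
  dsub-id σ≗id (ψ ∧ χ) = cong₂ _∧_ (dsub-id σ≗id ψ) (dsub-id σ≗id χ)

  atomSub-id : ∀ {n} {σ : Subst n n} → σ ≗ avar → ∀ r → atomSub σ r ≡ r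
  atomSub-id σ≗id (avar x) = σ≗id x
  atomSub-id σ≗id (aend e) = refl

  liftsC-id : ∀ {Γ} p {σ : CSub Γ Γ} → IsIdC σ → IsIdC (liftsC p σ)
  liftsC-id zero    σ≗id = σ≗id
  liftsC-id (suc p) σ≗id = liftC-id (liftsC-id p σ≗id)
    where
    liftC-id : ∀ {Γ} {σ : CSub Γ Γ} → IsIdC σ → IsIdC (liftC σ)
    liftC-id {ctx m} σ≗id zero    = refl
    liftC-id {ctx m} σ≗id (suc x) = cong wkAtom (σ≗id x)
    liftC-id {⊥ctx}  σ≗id         = tt

  mutual
    subTm-id : ∀ {n} {σ : Subst n n} → σ ≗ avar → ∀ t → subTm σ t ≡ t
    subTm-id σ≗id pt             = refl
    subTm-id σ≗id (lp a ψ)       = cong (lp a) (dsub-id σ≗id ψ)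
    subTm-id σ≗id (sq ρ ψ χ)     = cong₂ (sq ρ) (dsub-id σ≗id ψ) (dsub-id σ≗id χ)
    subTm-id σ≗id (fill e r φ u) =
      cong₂ (λ (r , φ) → fill e r φ) (cong₂ _,_ (atomSub-id σ≗id r) (subEntries-id σ≗id φ)) (subTm-id σ≗id u)

    subEntries-id : ∀ {n p} {σ : Subst n n} → σ ≗ avar → (φ : List (Entry n p)) → subEntries σ φ ≡ φ
    subEntries-id σ≗id []      = refl
    subEntries-id σ≗id (E ∷ φ) = cong₂ _∷_ (subEntry-id σ≗id E) (subEntries-id σ≗id φ)

    subEntry-id : ∀ {n p} {σ : Subst n n} → σ ≗ avar → (E : Entry n p) → subEntry σ E ≡ E
    subEntry-id {n} {p} σ≗id (aend false ≔ false ↦ c) =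
      cong (aend false ≔ false ↦_) (cellSub-id (liftsC-id {ctx n} p σ≗id) c)
    subEntry-id {n} {p} σ≗id (aend true  ≔ true  ↦ c) =
      cong (aend true ≔ true ↦_) (cellSub-id (liftsC-id {ctx n} p σ≗id) c)
    subEntry-id {n} {p} σ≗id (aend false ≔ true  ↦ c) =
      cong (aend false ≔ true ↦_) (cellSub-id (liftsC-id {⊥ctx} p tt) c)
    subEntry-id {n} {p} σ≗id (aend true  ≔ false ↦ c) =
      cong (aend true ≔ false ↦_) (cellSub-id (liftsC-id {⊥ctx} p tt) c)
    subEntry-id {suc n} {p} {σ} σ≗id (avar i ≔ e ↦ c) with σ i | σ≗id i
    ... | _ | refl = cong (avar i ≔ e ↦_) (cellSub-id (liftsC-id {ctx n} p restricted-id) c)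
      where
      restricted-id : ∀ x → atomSub (dropAt i e) (σ (punchIn i x)) ≡ avar x
      restricted-id x = trans (cong (atomSub (dropAt i e)) (σ≗id (punchIn i x))) (dropAt-punchIn i e x)

    cellSub-id : ∀ {Γ} {σ : CSub Γ Γ} → IsIdC σ → (c : CellsC Γ) → cellSub σ c ≡ c
    cellSub-id {ctx m} σ≗id c = subTm-id σ≗id c
    cellSub-id {⊥ctx}  σ≗id c = refl

  lift-id : ∀ {n} → lift {n} avar ≗ avar
  lift-id zero    = refl
  lift-id (suc x) = refl

  lift-dropAt-punchIn : ∀ {n} (i : Fin (suc n)) b → lift (λ x → dropAt i b (punchIn i x)) ≗ avar
  lift-dropAt-punchIn i b zero    = refl
  lift-dropAt-punchIn i b (suc x) = cong wkAtom (dropAt-punchIn i b x)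

  lift-dropAt : ∀ c → lift (dropAt {0} zero c) ≗ dropAt (suc zero) c
  lift-dropAt c zero       = refl
  lift-dropAt c (suc zero) = refl

  -- inst and instSub are the same substitution (id, a/j), defined twice in Defs.
  inst-end : ∀ {n} e → inst {n} (aend e) ≗ dropAt zero e
  inst-end e zero    = refl
  inst-end e (suc x) = refl

  instSub-end : ∀ {n} e → instSub (ctx n) (aend e) ≗ dropAt zero e
  instSub-end e zero    = refl
  instSub-end e (suc x) = refl

  face : ∀ {n} → Fin (suc n) → Bool → Tm (suc n) → Tm n
  face x b t = subTm (dropAt x b) t

  ≈-reflexive : ∀ {n} {t u : Tm n} → t ≡ u → t ≈ u
  ≈-reflexive refl = ≈-refl

  ≈-subTm-id : ∀ {n} {σ τ : Subst n n} → σ ≗ avar → τ ≗ avar → ∀ {P Q} → P ≈ Q → subTm σ P ≈ subTm τ Q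
  ≈-subTm-id σ≗id τ≗id P≈Q = subst₂ _≈_ (sym (subTm-id σ≗id _)) (sym (subTm-id τ≗id _)) P≈Q

  EqC-refl : ∀ Γ (c : CellsC Γ) → EqC Γ c c
  EqC-refl (ctx m) c = ≈-refl
  EqC-refl ⊥ctx    c = tt

  EqC-reflexive : ∀ Γ {c d : CellsC Γ} → c ≡ d → EqC Γ c d
  EqC-reflexive Γ refl = EqC-refl Γ _

  EqC-trans : ∀ Γ {c d f : CellsC Γ} → EqC Γ c d → EqC Γ d f → EqC Γ c f
  EqC-trans (ctx m) c≈d d≈f = ≈-trans c≈d d≈f
  EqC-trans ⊥ctx    _   _   = tt

  -- The split on n below lets restrictSub compute.
  Agree-refl : ∀ {n p} (E : Entry n p) → Agree E E
  Agree-refl {n} {p} (aend false ≔ false ↦ t) = EqC-refl (ctx n ⊕ p) _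
  Agree-refl {n} {p} (aend true  ≔ true  ↦ t) = EqC-refl (ctx n ⊕ p) _
  Agree-refl {n} {p} (aend false ≔ true  ↦ t) = EqC-refl (⊥ctx ⊕ p) _
  Agree-refl {n} {p} (aend true  ≔ false ↦ t) = EqC-refl (⊥ctx ⊕ p) _
  Agree-refl {suc zero} {p} (avar i ≔ e ↦ t) with i ≟ i
  ... | no i≢i = ⊥-elim (i≢i refl)
  ... | yes _ with e
  ...   | false = EqC-reflexive (ctx zero ⊕ p) (cellSub-cong (liftsC-cong p λ x → sym (dropAt-punchIn i false x)) t)
  ...   | true  = EqC-reflexive (ctx zero ⊕ p) (cellSub-cong (liftsC-cong p λ x → sym (dropAt-punchIn i true x)) t)
  Agree-refl {suc (suc n)} {p} (avar i ≔ e ↦ t) with i ≟ i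
  ... | no i≢i = ⊥-elim (i≢i refl)
  ... | yes _ with e
  ...   | false = EqC-reflexive (ctx (suc n) ⊕ p) (cellSub-cong (liftsC-cong p λ x → sym (dropAt-punchIn i false x)) t)
  ...   | true  = EqC-reflexive (ctx (suc n) ⊕ p) (cellSub-cong (liftsC-cong p λ x → sym (dropAt-punchIn i true x)) t)

  Agree-opposite : ∀ {n} (x : Atom n) e (t : CellsC (restrict n x e ⊕ 1)) (t' : CellsC (restrict n x (not e) ⊕ 1))
                 → Agree {p = 1} (x ≔ e ↦ t) (x ≔ not e ↦ t')
  Agree-opposite (aend false) false t t' = tt
  Agree-opposite (aend false) true  t t' = tt
  Agree-opposite (aend true)  false t t' = tt
  Agree-opposite (aend true)  true  t t' = tt
  Agree-opposite {suc zero} (avar i) e t t' with i ≟ i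
  ... | no i≢i = ⊥-elim (i≢i refl)
  ... | yes _ with e
  ...   | false = tt
  ...   | true  = tt
  Agree-opposite {suc (suc n)} (avar i) e t t' with i ≟ i
  ... | no i≢i = ⊥-elim (i≢i refl)
  ... | yes _ with e
  ...   | false = tt
  ...   | true  = tt

  AgreeAll : ∀ {n p} → List (Entry n p) → List (Entry n p) → Set
  AgreeAll φ ψ = All (λ E → All (Agree E) ψ) φ

  KanBdry-++ : ∀ {n p} {φ ψ : List (Entry n p)} → All KanEntry φ → All KanEntry ψ
             → AgreeAll φ φ → AgreeAll φ ψ → AgreeAll ψ φ → AgreeAll ψ ψ → KanBdry (φ ++ ψ)
  KanBdry-++ kφ kψ φφ φψ ψφ ψψ =
    ++⁺ kφ kψ , ++⁺ (All.zipWith (uncurry ++⁺) (φφ , φψ)) (All.zipWith (uncurry ++⁺) (ψφ , ψψ))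

  pairBdry : ∀ {n} (x : Atom n) → ((e : Bool) → CellsC (restrict n x e ⊕ 1)) → List (Entry n 1)
  pairBdry x C = (x ≔ false ↦ C false) ∷ (x ≔ true ↦ C true) ∷ []

  pairBdry-agree : ∀ {n} (x : Atom n) C → AgreeAll (pairBdry x C) (pairBdry x C)
  pairBdry-agree x C = (Agree-refl {p = 1} (x ≔ false ↦ C false) ∷ Agree-opposite x false _ _ ∷ [])
                     ∷ (Agree-opposite x true _ _ ∷ Agree-refl {p = 1} (x ≔ true ↦ C true) ∷ []) ∷ []

  BaseOf : ∀ {n} → Bool → List (Entry n 1) → Tm n → Set
  BaseOf e φ u = All (BdEntry u ∘ instJ (aend e)) φ

  fill-isKan : ∀ {n e r φ} {u : Tm n} → KanBdry φ → IsKan u → BaseOf e φ u → IsKan (fill e r φ u)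
  fill-isKan kφ ku base = fill-kan kφ ku (map⁺ base)

  subEntries-++ : ∀ {m n p} (σ : Subst m n) (φ ψ : List (Entry n p))
                → subEntries σ (φ ++ ψ) ≡ subEntries σ φ ++ subEntries σ ψ
  subEntries-++ σ []      ψ = refl
  subEntries-++ σ (E ∷ φ) ψ = cong (subEntry σ E ∷_) (subEntries-++ σ φ ψ)

  face-fill-++ : ∀ {n} x b {e} r (φ ψ : List (Entry (suc n) 1)) (u : Tm (suc n)) {φ′ ψ′}
               → subEntries (dropAt x b) φ ≡ φ′ → subEntries (dropAt x b) ψ ≡ ψ′
               → face x b (fill e r (φ ++ ψ) u) ≡ fill e (atomSub (dropAt x b) r) (φ′ ++ ψ′) (face x b u)
  face-fill-++ x b r φ ψ u refl refl = cong (λ φ → fill _ _ φ _) (subEntries-++ (dropAt x b) φ ψ)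

  ptC : (Γ : Ctx) → CellsC Γ
  ptC (ctx m) = pt
  ptC ⊥ctx    = tt

  lpC : Fin N → (Γ : Ctx) → CellsC (ext Γ)
  lpC a (ctx m) = lp a (var zero)
  lpC a ⊥ctx    = tt

  cellSub-ptC : ∀ {Γ Δ} (σ : CSub Γ Δ) → cellSub σ (ptC Δ) ≡ ptC Γ
  cellSub-ptC {ctx m} {ctx n} σ = refl
  cellSub-ptC {ctx m} {⊥ctx} ()
  cellSub-ptC {⊥ctx}          σ = refl

  cellSub-lpC : ∀ {Γ Δ} a (σ : CSub Γ Δ) → cellSub (liftC σ) (lpC a Δ) ≡ lpC a Γ
  cellSub-lpC {ctx m} {ctx n} a σ = refl
  cellSub-lpC {ctx m} {⊥ctx} a ()
  cellSub-lpC {⊥ctx}          a σ = refl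

  IsKanC-ptC : ∀ Γ → IsKanC Γ (ptC Γ)
  IsKanC-ptC (ctx m) = pt-kan
  IsKanC-ptC ⊥ctx    = tt

  IsKanC-lpC : ∀ a Γ → IsKanC (ext Γ) (lpC a Γ)
  IsKanC-lpC a (ctx m) = lp-kan (InClass-var cls zero)
  IsKanC-lpC a ⊥ctx    = tt

  loopCell : ∀ {n} → Fin N → (x : Atom n) (e : Bool) → CellsC (restrict n x e ⊕ 1)
  loopCell a x false = ptC _
  loopCell a x true  = lpC a _

  loopBdry : ∀ {n} → Atom n → Fin N → List (Entry n 1)
  loopBdry x a = pairBdry x (loopCell a x)

  pointBdry : ∀ {n} → Atom n → List (Entry n 0)
  pointBdry x = (x ≔ false ↦ ptC _) ∷ (x ≔ true ↦ ptC _) ∷ []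

  stepAlong : ∀ {n} → Atom n → Tm n → Fin N × Bool → Tm n
  stepAlong x t (a , s) = fill (not s) (aend s) (loopBdry x a) t

  wordAlong : ∀ {n} → Atom n → Tm n → Word N → Tm n
  wordAlong x = foldl (stepAlong x)

  ⌜∷ʳ⌝ : ∀ v l → ⌜ v ∷ʳ l ⌝ ≡ stepAlong (avar zero) ⌜ v ⌝ l
  ⌜∷ʳ⌝ v l = foldl-++ (stepAlong (avar zero)) pt v (l ∷ [])

  subEntries-loopBdry : ∀ {m n} (σ : Subst m n) x a → subEntries σ (loopBdry x a) ≡ loopBdry (atomSub σ x) a
  subEntries-loopBdry σ x a =
    cong₂ (λ p l → (atomSub σ x ≔ false ↦ p) ∷ (atomSub σ x ≔ true ↦ l) ∷ []) (cellSub-ptC _) (cellSub-lpC a _)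

  subTm-stepAlong : ∀ {m n} (σ : Subst m n) x t l → subTm σ (stepAlong x t l) ≡ stepAlong (atomSub σ x) (subTm σ t) l
  subTm-stepAlong σ x t (a , s) = cong (λ φ → fill (not s) (aend s) φ (subTm σ t)) (subEntries-loopBdry σ x a)

  subTm-wordAlong : ∀ {m n} (σ : Subst m n) x t v → subTm σ (wordAlong x t v) ≡ wordAlong (atomSub σ x) (subTm σ t) v
  subTm-wordAlong σ x t []      = refl
  subTm-wordAlong σ x t (l ∷ v) =
    trans (subTm-wordAlong σ x (stepAlong x t l) v) (cong (λ u → wordAlong (atomSub σ x) u v) (subTm-stepAlong σ x t l))

  face-wordAlong : ∀ {n} x b (y : Atom (suc n)) v → face x b (wordAlong y pt v) ≡ wordAlong (atomSub (dropAt x b) y) pt v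
  face-wordAlong x b y v = subTm-wordAlong (dropAt x b) y pt v

  face-loopFill : ∀ {n} x b {e} (r y : Atom (suc n)) a v
                → face x b (fill e r (loopBdry y a) (wordAlong y pt v))
                ≡ fill e (atomSub (dropAt x b) r) (loopBdry (atomSub (dropAt x b) y) a) (wordAlong (atomSub (dropAt x b) y) pt v)
  face-loopFill x b r y a v = cong₂ (fill _ _) (subEntries-loopBdry (dropAt x b) y a) (face-wordAlong x b y v)

  lp-end : ∀ {n} a e → lp {n} a (end e) ≈ pt
  lp-end a false = lp-i0 ≐-refl
  lp-end a true  = lp-i1 ≐-refl

  loopBdry-kan : ∀ {n} (x : Atom n) a → KanBdry (loopBdry x a)
  loopBdry-kan x a = (IsKanC-ptC _ ∷ IsKanC-lpC a _ ∷ []) , pairBdry-agree x (loopCell a x)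

  loopFill-kan : ∀ {n} e r (x : Atom n) a {t : Tm n} → IsKan t → HasBdry t (pointBdry x)
               → IsKan (fill e r (loopBdry x a) t)
  loopFill-kan {n} e r x a {t} kt (t₀ ∷ t₁ ∷ []) = fill-kan (loopBdry-kan x a) kt (base₀ ∷ base₁ ∷ [])
    where
    R₀ R₁ : Ctx
    R₀ = restrict n x false
    R₁ = restrict n x true
    base₀ : EqC R₀ (cellSub (constr x false) t) (cellSub (instSub R₀ (atomSubC (constr x false) (aend e))) (ptC (ext R₀)))
    base₀ = subst (EqC R₀ (cellSub (constr x false) t)) (sym (cellSub-ptC _)) t₀
    lpC-end : ∀ R (σ : CSub R (ctx n)) → EqC R (ptC R) (cellSub (instSub R (atomSubC σ (aend e))) (lpC a R))
    lpC-end (ctx m) σ = ≈-sym (lp-end a e)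
    lpC-end ⊥ctx    σ = tt
    base₁ : EqC R₁ (cellSub (constr x true) t) (cellSub (instSub R₁ (atomSubC (constr x true) (aend e))) (lpC a R₁))
    base₁ = EqC-trans R₁ t₁ (lpC-end R₁ (constr x true))

  IsKan⋆ : ∀ {n} → Tm n → Set
  IsKan⋆ t = IsKan t × t ≈ pt

  pt-kan⋆ : ∀ {n} → IsKan⋆ {n} pt
  pt-kan⋆ = pt-kan , ≈-refl

  pointBdry-end : ∀ {n} b {t : Tm n} → t ≈ pt → HasBdry t (pointBdry (aend b))
  pointBdry-end false t≈pt = ≈-trans (≈-reflexive (subTm-id (λ _ → refl) _)) t≈pt ∷ tt ∷ []
  pointBdry-end true  t≈pt = tt ∷ ≈-trans (≈-reflexive (subTm-id (λ _ → refl) _)) t≈pt ∷ []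

  module _ {n} (e : Bool) (r : Atom n) (a : Fin N) {t : Tm n} (t⋆ : IsKan⋆ t) where

    endLoopFill-kan : ∀ b → IsKan (fill e r (loopBdry (aend b) a) t)
    endLoopFill-kan b = loopFill-kan e r (aend b) a (proj₁ t⋆) (pointBdry-end b (proj₂ t⋆))

    endLoopFill₀ : fill e r (loopBdry (aend false) a) t ≈ pt
    endLoopFill₀ = fill-bd0 (endLoopFill-kan false) (here refl)

    endLoopFill₁ : fill e r (loopBdry (aend true) a) t ≈ lp a (atomTm r)
    endLoopFill₁ = fill-bd1 (endLoopFill-kan true) (there (here refl))

  endLoopFill-kan⋆ : ∀ {n e} b c a {t : Tm n} → IsKan⋆ t → IsKan⋆ (fill e (aend c) (loopBdry (aend b) a) t)
  endLoopFill-kan⋆ false c a t⋆ = endLoopFill-kan _ _ a t⋆ false , endLoopFill₀ _ _ a t⋆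
  endLoopFill-kan⋆ true  c a t⋆ = endLoopFill-kan _ _ a t⋆ true , ≈-trans (endLoopFill₁ _ _ a t⋆) (lp-end a c)

  wordAlong-end : ∀ {n} b v {t : Tm n} → IsKan⋆ t → IsKan⋆ (wordAlong (aend b) t v)
  wordAlong-end b []            t⋆ = t⋆
  wordAlong-end b ((a , s) ∷ v) t⋆ = wordAlong-end b v (endLoopFill-kan⋆ b s a t⋆)

  record IsKanLoop {n} (i : Fin (suc n)) (t : Tm (suc n)) : Set where
    constructor kanLoop
    field
      kan  : IsKan t
      ends : ∀ b → IsKan⋆ (face i b t)

  pt-kanLoop : ∀ {n} (i : Fin (suc n)) → IsKanLoop i pt
  pt-kanLoop i = kanLoop pt-kan (λ _ → pt-kan⋆)

  varLoopFill-kan : ∀ {n} e r (i : Fin (suc n)) a {t} → IsKanLoop i t → IsKan (fill e r (loopBdry (avar i) a) t)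
  varLoopFill-kan e r i a (kanLoop kt ends) = loopFill-kan e r (avar i) a kt (proj₂ (ends false) ∷ proj₂ (ends true) ∷ [])

  wordAlong-var : ∀ {n} (i : Fin (suc n)) v {t} → IsKanLoop i t → IsKanLoop i (wordAlong (avar i) t v)
  wordAlong-var i []      loop = loop
  wordAlong-var i (l ∷ v) loop = wordAlong-var i v (step l loop)
    where
    step : ∀ l {t} → IsKanLoop i t → IsKanLoop i (stepAlong (avar i) t l)
    step (a , s) {t} loop = kanLoop (varLoopFill-kan _ _ i a loop) ends′
      where
      ends′ : ∀ b → IsKan⋆ (face i b (stepAlong (avar i) t (a , s)))
      ends′ b rewrite subTm-stepAlong (dropAt i b) (avar i) t (a , s) | dropAt-self i b =
        endLoopFill-kan⋆ b s a (IsKanLoop.ends loop b)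

  wordAlong-kanLoop : ∀ (y : Atom 1) v → IsKanLoop zero (wordAlong y pt v)
  wordAlong-kanLoop (avar zero) v = wordAlong-var zero v (pt-kanLoop zero)
  wordAlong-kanLoop (aend b)    v =
    kanLoop (proj₁ (wordAlong-end b v pt-kan⋆))
            (λ c → subst IsKan⋆ (sym (face-wordAlong zero c (aend b) v)) (wordAlong-end b v pt-kan⋆))

  loopFill-kanLoop : ∀ e (r y : Atom 1) a v → IsKanLoop zero (fill e r (loopBdry y a) (wordAlong y pt v))
  loopFill-kanLoop e r y a v =
    kanLoop (kan′ y) λ c → subst IsKan⋆ (sym (face-loopFill zero c r y a v)) (end⋆ (atomSub (dropAt zero c) r) _)
    where
    kan′ : ∀ y → IsKan (fill e r (loopBdry y a) (wordAlong y pt v))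
    kan′ (avar zero) = varLoopFill-kan e r zero a (wordAlong-kanLoop (avar zero) v)
    kan′ (aend b)    = endLoopFill-kan e r a (wordAlong-end b v pt-kan⋆) b
    end⋆ : ∀ (r y : Atom 0) → IsKan⋆ (fill e r (loopBdry y a) (wordAlong y pt v))
    end⋆ (aend c) (aend b) = endLoopFill-kan⋆ b c a (wordAlong-end b v pt-kan⋆)

  endBdry : ∀ {n} → Bool → Tm (suc n) → List (Entry n 1)
  endBdry false P = (aend false ≔ false ↦ P) ∷ (aend false ≔ true ↦ tt) ∷ []
  endBdry true  P = (aend true ≔ false ↦ tt) ∷ (aend true ≔ true ↦ P) ∷ []

  endBdry-kan : ∀ {n} b {P : Tm (suc n)} → IsKan P → All KanEntry (endBdry b P)
  endBdry-kan false kP = kP ∷ tt ∷ []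
  endBdry-kan true  kP = tt ∷ kP ∷ []

  endBdry-agree : ∀ {n} b c {P Q : Tm (suc n)} → P ≈ Q → AgreeAll (endBdry b P) (endBdry c Q)
  endBdry-agree false false P≈Q = (≈-subTm-id lift-id lift-id P≈Q ∷ tt ∷ []) ∷ (tt ∷ tt ∷ []) ∷ []
  endBdry-agree false true  P≈Q = (tt ∷ ≈-subTm-id lift-id lift-id P≈Q ∷ []) ∷ (tt ∷ tt ∷ []) ∷ []
  endBdry-agree true  false P≈Q = (tt ∷ tt ∷ []) ∷ (≈-subTm-id lift-id lift-id P≈Q ∷ tt ∷ []) ∷ []
  endBdry-agree true  true  P≈Q = (tt ∷ tt ∷ []) ∷ (tt ∷ ≈-subTm-id lift-id lift-id P≈Q ∷ []) ∷ []

  endBdry-base : ∀ {n e} b {P : Tm (suc n)} {u : Tm n} → u ≈ face zero e P → BaseOf e (endBdry b P) u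
  endBdry-base false u≈P = subst₂ _≈_ (sym (subTm-id (λ _ → refl) _)) (sym (subTm-cong (instSub-end _) _)) u≈P ∷ tt ∷ []
  endBdry-base true  u≈P = tt ∷ subst₂ _≈_ (sym (subTm-id (λ _ → refl) _)) (sym (subTm-cong (instSub-end _) _)) u≈P ∷ []

  fill-endBdry : ∀ {n e c φ} b {u : Tm n} {P} → IsKan (fill e (aend c) φ u) → endBdry b P ⊆ φ
               → fill e (aend c) φ u ≈ face zero c P
  fill-endBdry false K endBdry⊆φ =
    ≈-trans (fill-bd0 K (endBdry⊆φ (here refl))) (≈-reflexive (subTm-cong (inst-end _) _))
  fill-endBdry true  K endBdry⊆φ =
    ≈-trans (fill-bd1 K (endBdry⊆φ (there (here refl)))) (≈-reflexive (subTm-cong (inst-end _) _))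

  subEntries-endBdry : ∀ {m n} (σ : Subst m n) b P → subEntries σ (endBdry b P) ≡ endBdry b (subTm (lift σ) P)
  subEntries-endBdry σ false P = refl
  subEntries-endBdry σ true  P = refl

  subEntries-pairBdry-self : ∀ {n} (i : Fin (suc n)) b (X : Bool → Tm (suc n))
                           → subEntries (dropAt i b) (pairBdry (avar i) X) ≡ endBdry b (X b)
  subEntries-pairBdry-self {zero} i b X with i ≟ i
  ... | no i≢i = ⊥-elim (i≢i refl)
  ... | yes _ with b
  ...   | false = cong (endBdry false) (subTm-id (lift-dropAt-punchIn i false) (X false))
  ...   | true  = cong (endBdry true) (subTm-id (lift-dropAt-punchIn i true) (X true))
  subEntries-pairBdry-self {suc n} i b X with i ≟ i
  ... | no i≢i = ⊥-elim (i≢i refl)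
  ... | yes _ with b
  ...   | false = cong (endBdry false) (subTm-id (lift-dropAt-punchIn i false) (X false))
  ...   | true  = cong (endBdry true) (subTm-id (lift-dropAt-punchIn i true) (X true))

  module _ {P : Tm 2} {Q : Bool → Tm 1} (P≈Q : ∀ c → face (suc zero) c P ≈ Q c) where

    private
      end-var : ∀ c → Agree {1} {1} (aend false ≔ false ↦ P) (avar zero ≔ c ↦ Q c)
      end-var c = subst₂ _≈_ (sym (subTm-cong (lift-dropAt c) P)) (sym (subTm-id (λ { zero → refl }) (Q c))) (P≈Q c)

      var-end : ∀ c → Agree {1} {1} (avar zero ≔ c ↦ Q c) (aend false ≔ false ↦ P)
      var-end c = subst₂ _≈_ (sym (subTm-id lift-id (Q c))) (sym (subTm-cong (lift-dropAt c) P)) (≈-sym (P≈Q c))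

    endBdry-pairBdry-agree : ∀ b → AgreeAll (endBdry b P) (pairBdry (avar zero) Q)
    endBdry-pairBdry-agree false = (end-var false ∷ end-var true ∷ []) ∷ (tt ∷ tt ∷ []) ∷ []
    endBdry-pairBdry-agree true  = (tt ∷ tt ∷ []) ∷ (end-var false ∷ end-var true ∷ []) ∷ []

    pairBdry-endBdry-agree : ∀ b → AgreeAll (pairBdry (avar zero) Q) (endBdry b P)
    pairBdry-endBdry-agree false = (var-end false ∷ tt ∷ []) ∷ (var-end true ∷ tt ∷ []) ∷ []
    pairBdry-endBdry-agree true  = (tt ∷ var-end false ∷ []) ∷ (tt ∷ var-end true ∷ []) ∷ []

  cornerFill : ∀ e b c {P Q : Tm 1} {V : Tm 0} → IsKanLoop zero P → IsKanLoop zero Q → P ≈ Q → IsKan⋆ V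
             → IsKan⋆ (fill e (aend (not e)) (endBdry b P ++ endBdry c Q) V)
  cornerFill e b c {P} {Q} {V} (kanLoop kP P-ends) (kanLoop kQ Q-ends) P≈Q (kV , V≈pt) =
    K , ≈-trans (fill-endBdry b K (xs⊆xs++ys _ _)) (proj₂ (P-ends (not e)))
    where
    K : IsKan (fill e (aend (not e)) (endBdry b P ++ endBdry c Q) V)
    K = fill-isKan (KanBdry-++ (endBdry-kan b kP) (endBdry-kan c kQ)
                     (endBdry-agree b b ≈-refl) (endBdry-agree b c P≈Q)
                     (endBdry-agree c b (≈-sym P≈Q)) (endBdry-agree c c ≈-refl))
                   kV
                   (++⁺ (endBdry-base b (≈-trans V≈pt (≈-sym (proj₂ (P-ends e)))))
                        (endBdry-base c (≈-trans V≈pt (≈-sym (proj₂ (Q-ends e))))))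

  -- A face of a box (face₀ and face₁ below) is a filling of this shape, in one of the two orders.
  module SideFill (e b : Bool) {P : Tm 2} {Q : Bool → Tm 1} {V : Tm 1}
    (kP : IsKan P) (P-sides : ∀ c → IsKanLoop zero (face (suc zero) c P))
    (Q-loops : ∀ c → IsKanLoop zero (Q c)) (P≈Q : ∀ c → face (suc zero) c P ≈ Q c)
    (V-loop : IsKanLoop zero V) (V≈P : V ≈ face zero e P) where

    private
      open IsKanLoop

      φ ψ : List (Entry 1 1)
      φ = endBdry b P
      ψ = pairBdry (avar zero) Q

      kanφ : All KanEntry φ
      kanφ = endBdry-kan b kP

      kanψ : All KanEntry ψ
      kanψ = kan (Q-loops false) ∷ kan (Q-loops true) ∷ []

      baseψ : BaseOf e ψ V
      baseψ = base false ∷ base true ∷ []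
        where
        base : ∀ c → face zero c V ≈ subTm (instSub (ctx 0) (aend e)) (Q c)
        base c = subst (face zero c V ≈_) (sym (subTm-cong (instSub-end e) (Q c)))
                       (≈-trans (proj₂ (ends V-loop c)) (≈-sym (proj₂ (ends (Q-loops c) e))))

      faceφ : ∀ c → subEntries (dropAt zero c) φ ≡ endBdry b (face (suc zero) c P)
      faceφ c = trans (subEntries-endBdry _ b P) (cong (endBdry b) (subTm-cong (lift-dropAt c) P))

      faceψ : ∀ c → subEntries (dropAt zero c) ψ ≡ endBdry c (Q c)
      faceψ c = subEntries-pairBdry-self zero c Q

    endFirst : IsKanLoop zero (fill e (aend (not e)) (φ ++ ψ) V) × fill e (aend (not e)) (φ ++ ψ) V ≈ face zero (not e) P
    endFirst = kanLoop K corner , fill-endBdry b K (xs⊆xs++ys φ ψ)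
      where
      K : IsKan (fill e (aend (not e)) (φ ++ ψ) V)
      K = fill-isKan (KanBdry-++ kanφ kanψ (endBdry-agree b b ≈-refl) (endBdry-pairBdry-agree P≈Q b)
                                 (pairBdry-endBdry-agree P≈Q b) (pairBdry-agree (avar zero) Q))
                     (kan V-loop) (++⁺ (endBdry-base b V≈P) baseψ)
      corner : ∀ c → IsKan⋆ (face zero c (fill e (aend (not e)) (φ ++ ψ) V))
      corner c = subst IsKan⋆ (sym (face-fill-++ zero c (aend (not e)) φ ψ V (faceφ c) (faceψ c)))
                       (cornerFill e b c (P-sides c) (Q-loops c) (P≈Q c) (ends V-loop c))

    endLast : IsKanLoop zero (fill e (aend (not e)) (ψ ++ φ) V) × fill e (aend (not e)) (ψ ++ φ) V ≈ face zero (not e) P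
    endLast = kanLoop K corner , fill-endBdry b K (xs⊆ys++xs φ ψ)
      where
      K : IsKan (fill e (aend (not e)) (ψ ++ φ) V)
      K = fill-isKan (KanBdry-++ kanψ kanφ (pairBdry-agree (avar zero) Q) (pairBdry-endBdry-agree P≈Q b)
                                 (endBdry-pairBdry-agree P≈Q b) (endBdry-agree b b ≈-refl))
                     (kan V-loop) (++⁺ baseψ (endBdry-base b V≈P))
      corner : ∀ c → IsKan⋆ (face zero c (fill e (aend (not e)) (ψ ++ φ) V))
      corner c = subst IsKan⋆ (sym (face-fill-++ zero c (aend (not e)) ψ φ V (faceψ c) (faceφ c)))
                       (cornerFill e c b (Q-loops c) (P-sides c) (≈-sym (P≈Q c)) (ends V-loop c))

  record Sides : Set where
    constructor sides
    field
      at₀ at₁ : Bool → Tm 1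

  open Sides

  sideAt : Sides → Fin 2 → Bool → Tm 1
  sideAt F zero       = at₀ F
  sideAt F (suc zero) = at₁ F

  record KanSquare (T : Tm 2) (F : Sides) : Set where
    field
      kan       : IsKan T
      side      : ∀ x b → face x b T ≈ sideAt F x b
      side-loop : ∀ x b → IsKanLoop zero (face x b T)

  KanSquare-resp : ∀ {T F G} → KanSquare T F → (∀ x b → sideAt F x b ≈ sideAt G x b) → KanSquare T G
  KanSquare-resp T-sq F≈G = record { kan = kan ; side = λ x b → ≈-trans (side x b) (F≈G x b) ; side-loop = side-loop }
    where open KanSquare T-sq

  box : Bool → (Bool → Tm 2) → (Bool → Tm 2) → Tm 2 → Tm 2
  box e X Y U = fill e (aend (not e)) (pairBdry (avar zero) X ++ pairBdry (avar (suc zero)) Y) U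

  boxSides : Bool → (Bool → Sides) → (Bool → Sides) → Sides
  boxSides e FX FY = sides (λ c → at₀ (FX c) (not e)) (λ b → at₀ (FY b) (not e))

  module _ (e : Bool) {X Y : Bool → Tm 2} {U : Tm 2} {FX FY : Bool → Sides} {FU : Sides}
    (X-sq : ∀ c → KanSquare (X c) (FX c)) (Y-sq : ∀ b → KanSquare (Y b) (FY b)) (U-sq : KanSquare U FU)
    (edge : ∀ c b → at₁ (FX c) b ≈ at₁ (FY b) c)
    (base₀ : ∀ c → at₀ FU c ≈ at₀ (FX c) e) (base₁ : ∀ b → at₁ FU b ≈ at₀ (FY b) e) where

    private
      open KanSquare

      φX φY : List (Entry 2 1)
      φX = pairBdry (avar zero) X
      φY = pairBdry (avar (suc zero)) Y

      edgeXY : ∀ c b → face (suc zero) b (X c) ≈ face (suc zero) c (Y b)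
      edgeXY c b = ≈-trans (side (X-sq c) (suc zero) b) (≈-trans (edge c b) (≈-sym (side (Y-sq b) (suc zero) c)))

      baseUX : ∀ c → face zero c U ≈ face zero e (X c)
      baseUX c = ≈-trans (side U-sq zero c) (≈-trans (base₀ c) (≈-sym (side (X-sq c) zero e)))

      baseUY : ∀ b → face (suc zero) b U ≈ face zero e (Y b)
      baseUY b = ≈-trans (side U-sq (suc zero) b) (≈-trans (base₁ b) (≈-sym (side (Y-sq b) zero e)))

      agreeXY : ∀ c b → Agree {2} {1} (avar zero ≔ c ↦ X c) (avar (suc zero) ≔ b ↦ Y b)
      agreeXY c b = subst₂ _≈_ (sym (subTm-cong (λ { zero → refl ; (suc zero) → refl }) (X c)))
                               (sym (subTm-cong (λ { zero → refl ; (suc zero) → refl }) (Y b))) (edgeXY c b)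

      agreeYX : ∀ b c → Agree {2} {1} (avar (suc zero) ≔ b ↦ Y b) (avar zero ≔ c ↦ X c)
      agreeYX b c = subst₂ _≈_ (sym (subTm-cong (λ { zero → refl ; (suc zero) → refl }) (Y b)))
                               (sym (subTm-cong (λ { zero → refl ; (suc zero) → refl }) (X c))) (≈-sym (edgeXY c b))

      baseX : BaseOf e φX U
      baseX = base false ∷ base true ∷ []
        where
        base : ∀ c → face zero c U ≈ subTm (instSub (ctx 1) (aend e)) (X c)
        base c = subst (face zero c U ≈_) (sym (subTm-cong (instSub-end e) (X c))) (baseUX c)

      baseY : BaseOf e φY U
      baseY = base false ∷ base true ∷ []
        where
        base : ∀ b → face (suc zero) b U ≈ subTm (instSub (ctx 1) (aend e)) (Y b)
        base b = subst (face (suc zero) b U ≈_) (sym (subTm-cong (instSub-end e) (Y b))) (baseUY b)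

      kanBox : IsKan (box e X Y U)
      kanBox = fill-isKan (KanBdry-++ (kan (X-sq false) ∷ kan (X-sq true) ∷ []) (kan (Y-sq false) ∷ kan (Y-sq true) ∷ [])
                                      (pairBdry-agree (avar zero) X) agreeAllXY agreeAllYX (pairBdry-agree (avar (suc zero)) Y))
                          (kan U-sq) (++⁺ baseX baseY)
        where
        agreeAllXY : AgreeAll φX φY
        agreeAllXY = (agreeXY false false ∷ agreeXY false true ∷ []) ∷ (agreeXY true false ∷ agreeXY true true ∷ []) ∷ []
        agreeAllYX : AgreeAll φY φX
        agreeAllYX = (agreeYX false false ∷ agreeYX false true ∷ []) ∷ (agreeYX true false ∷ agreeYX true true ∷ []) ∷ []

      face₀ : ∀ c → face zero c (box e X Y U)
                  ≡ fill e (aend (not e)) (endBdry c (X c) ++ pairBdry (avar zero) (λ b → face (suc zero) c (Y b))) (face zero c U)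
      face₀ c = face-fill-++ zero c (aend (not e)) φX φY U (subEntries-pairBdry-self zero c X)
                  (cong₂ (λ y₀ y₁ → (avar zero ≔ false ↦ y₀) ∷ (avar zero ≔ true ↦ y₁) ∷ [])
                         (subTm-cong (λ { zero → refl ; (suc zero) → refl }) (Y false))
                         (subTm-cong (λ { zero → refl ; (suc zero) → refl }) (Y true)))

      face₁ : ∀ b → face (suc zero) b (box e X Y U)
                  ≡ fill e (aend (not e)) (pairBdry (avar zero) (λ c → face (suc zero) b (X c)) ++ endBdry b (Y b))
                         (face (suc zero) b U)
      face₁ b = face-fill-++ (suc zero) b (aend (not e)) φX φY U
                  (cong₂ (λ x₀ x₁ → (avar zero ≔ false ↦ x₀) ∷ (avar zero ≔ true ↦ x₁) ∷ [])
                         (subTm-cong (λ { zero → refl ; (suc zero) → refl }) (X false))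
                         (subTm-cong (λ { zero → refl ; (suc zero) → refl }) (X true)))
                  (subEntries-pairBdry-self (suc zero) b Y)

      module SideFill₀ (c : Bool) = SideFill e c (kan (X-sq c)) (side-loop (X-sq c) (suc zero))
                                      (λ b → side-loop (Y-sq b) (suc zero) c) (edgeXY c) (side-loop U-sq zero c) (baseUX c)

      module SideFill₁ (b : Bool) = SideFill e b (kan (Y-sq b)) (side-loop (Y-sq b) (suc zero))
                                      (λ c → side-loop (X-sq c) (suc zero) b) (λ c → ≈-sym (edgeXY c b))
                                      (side-loop U-sq (suc zero) b) (baseUY b)

    box-kanSquare : KanSquare (box e X Y U) (boxSides e FX FY)
    box-kanSquare = record { kan = kanBox ; side = side′ ; side-loop = side-loop′ }
      where
      side′ : ∀ x b → face x b (box e X Y U) ≈ sideAt (boxSides e FX FY) x b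
      side′ zero       c =
        ≈-trans (≈-reflexive (face₀ c)) (≈-trans (proj₂ (SideFill₀.endFirst c)) (side (X-sq c) zero (not e)))
      side′ (suc zero) b =
        ≈-trans (≈-reflexive (face₁ b)) (≈-trans (proj₂ (SideFill₁.endLast b)) (side (Y-sq b) zero (not e)))
      side-loop′ : ∀ x b → IsKanLoop zero (face x b (box e X Y U))
      side-loop′ zero       c = subst (IsKanLoop zero) (sym (face₀ c)) (proj₁ (SideFill₀.endFirst c))
      side-loop′ (suc zero) b = subst (IsKanLoop zero) (sym (face₁ b)) (proj₁ (SideFill₁.endLast b))

  ⋆Sides : Sides
  ⋆Sides = sides (λ _ → pt) (λ _ → pt)

  pt-square : KanSquare pt ⋆Sides
  pt-square = record { kan       = pt-kan
                     ; side      = λ { zero _ → ≈-refl ; (suc zero) _ → ≈-refl }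
                     ; side-loop = λ _ _ → pt-kanLoop zero }

  lp-end-kan⋆ : ∀ {n} a e → IsKan⋆ (lp {n} a (end e))
  lp-end-kan⋆ a e = lp-kan (InClass-end cls e) , lp-end a e

  loopSides : Fin N → Sides
  loopSides a = sides (λ _ → pt) (λ _ → lp a (var zero))

  loop-square : ∀ a → KanSquare (lp a (var zero)) (loopSides a)
  loop-square a = record { kan = lp-kan (InClass-var cls zero) ; side = side′ ; side-loop = side-loop′ }
    where
    side′ : ∀ x b → face x b (lp a (var zero)) ≈ sideAt (loopSides a) x b
    side′ zero       b = lp-end a b
    side′ (suc zero) b = ≈-refl
    side-loop′ : ∀ x b → IsKanLoop zero (face x b (lp a (var zero)))
    side-loop′ zero       false = kanLoop (lp-kan (InClass-end cls false)) (λ _ → lp-end-kan⋆ a false)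
    side-loop′ zero       true  = kanLoop (lp-kan (InClass-end cls true)) (λ _ → lp-end-kan⋆ a true)
    side-loop′ (suc zero) b     = kanLoop (lp-kan (InClass-var cls zero)) (lp-end-kan⋆ a)

  relSides : Fin M → Sides
  relSides ρ = sides (λ b → if b then lp (relB rel ρ) (var zero) else pt)
                     (λ c → lp (if c then relC rel ρ else relA rel ρ) (var zero))

  rel-square : ∀ ρ → KanSquare (sq ρ (var zero) (var (suc zero))) (relSides ρ)
  rel-square ρ =
    record { kan = sq-kan (InClass-var cls zero) (InClass-var cls (suc zero)) ; side = side′ ; side-loop = side-loop′ }
    where
    side′ : ∀ x b → face x b (sq ρ (var zero) (var (suc zero))) ≈ sideAt (relSides ρ) x b
    side′ zero       false = sq-j0 ≐-refl
    side′ zero       true  = sq-j1 ≐-refl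
    side′ (suc zero) false = sq-k0 ≐-refl
    side′ (suc zero) true  = sq-k1 ≐-refl
    corner : ∀ b c → IsKan⋆ (sq {0} ρ (end b) (end c))
    corner false c = sq-kan (InClass-end cls false) (InClass-end cls c) , sq-j0 ≐-refl
    corner true  c = sq-kan (InClass-end cls true) (InClass-end cls c) , ≈-trans (sq-j1 ≐-refl) (lp-end _ c)
    side-loop′ : ∀ x b → IsKanLoop zero (face x b (sq ρ (var zero) (var (suc zero))))
    side-loop′ zero       false = kanLoop (sq-kan (InClass-end cls false) (InClass-var cls zero)) (corner false)
    side-loop′ zero       true  = kanLoop (sq-kan (InClass-end cls true) (InClass-var cls zero)) (corner true)
    side-loop′ (suc zero) false = kanLoop (sq-kan (InClass-var cls zero) (InClass-end cls false)) (λ c → corner c false)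
    side-loop′ (suc zero) true  = kanLoop (sq-kan (InClass-var cls zero) (InClass-end cls true)) (λ c → corner c true)

  wordSides : Fin 2 → Word N → Sides
  wordSides zero       v = sides (λ _ → pt) (λ _ → ⌜ v ⌝)
  wordSides (suc zero) v = sides (λ _ → ⌜ v ⌝) (λ _ → pt)

  word-square : ∀ i v → KanSquare (wordAlong (avar i) pt v) (wordSides i v)
  word-square i v = record { kan = IsKanLoop.kan (wordAlong-var i v (pt-kanLoop i)) ; side = side′ i ; side-loop = side-loop′ }
    where
    open IsKanLoop
    side′ : ∀ i x b → face x b (wordAlong (avar i) pt v) ≈ sideAt (wordSides i v) x b
    side′ zero       zero       b = proj₂ (ends (wordAlong-var zero v (pt-kanLoop zero)) b)
    side′ zero       (suc zero) b = ≈-reflexive (face-wordAlong (suc zero) b (avar zero) v)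
    side′ (suc zero) zero       b = ≈-reflexive (face-wordAlong zero b (avar (suc zero)) v)
    side′ (suc zero) (suc zero) b = proj₂ (ends (wordAlong-var (suc zero) v (pt-kanLoop (suc zero))) b)
    side-loop′ : ∀ x b → IsKanLoop zero (face x b (wordAlong (avar i) pt v))
    side-loop′ x b = subst (IsKanLoop zero) (sym (face-wordAlong x b (avar i) v)) (wordAlong-kanLoop _ v)

  -- The filling that defines ⌜v a^s⌝ from ⌜v⌝ (see ⌜∷ʳ⌝), with its direction j as first variable.
  appendSquare : Fin N → Bool → Word N → Tm 2
  appendSquare a s v = fill (not s) (avar zero) (loopBdry (avar (suc zero)) a) (wordAlong (avar (suc zero)) pt v)

  appendSides : Fin N → Bool → Word N → Sides
  appendSides a s v = sides (at₀′ s) (λ b → if b then lp a (var zero) else pt)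
    where
    at₀′ : Bool → Bool → Tm 1
    at₀′ false c = ⌜ if c then v else v ∷ʳ (a , false) ⌝
    at₀′ true  c = ⌜ if c then v ∷ʳ (a , true) else v ⌝

  append-square : ∀ a s v → KanSquare (appendSquare a s v) (appendSides a s v)
  append-square a s v = record { kan = kan′ ; side = side′ ; side-loop = side-loop′ }
    where
    kan′ : IsKan (appendSquare a s v)
    kan′ = varLoopFill-kan (not s) (avar zero) (suc zero) a (wordAlong-var (suc zero) v (pt-kanLoop (suc zero)))
    side-loop′ : ∀ x b → IsKanLoop zero (face x b (appendSquare a s v))
    side-loop′ x b = subst (IsKanLoop zero) (sym (face-loopFill x b (avar zero) (avar (suc zero)) a v)) (loopFill-kanLoop _ _ _ a v)
    unchanged : ∀ e → fill e (aend e) (loopBdry (avar zero) a) ⌜ v ⌝ ≈ ⌜ v ⌝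
    unchanged e = fill-src (IsKanLoop.kan (loopFill-kanLoop e (aend e) (avar zero) a v))
    side₀ : ∀ s c → fill (not s) (aend c) (loopBdry (avar zero) a) ⌜ v ⌝ ≈ at₀ (appendSides a s v) c
    side₀ false false = ≈-reflexive (sym (⌜∷ʳ⌝ v (a , false)))
    side₀ false true  = unchanged true
    side₀ true  false = unchanged false
    side₀ true  true  = ≈-reflexive (sym (⌜∷ʳ⌝ v (a , true)))
    side′ : ∀ x b → face x b (appendSquare a s v) ≈ sideAt (appendSides a s v) x b
    side′ x b = ≈-trans (≈-reflexive (face-loopFill x b (avar zero) (avar (suc zero)) a v)) (side″ x b)
      where
      side″ : ∀ x b → fill (not s) (atomSub (dropAt x b) (avar zero)) (loopBdry (atomSub (dropAt x b) (avar (suc zero))) a)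
                             (wordAlong (atomSub (dropAt x b) (avar (suc zero))) pt v) ≈ sideAt (appendSides a s v) x b
      side″ zero       c     = side₀ s c
      side″ (suc zero) false = endLoopFill₀ (not s) (avar zero) a (wordAlong-end false v pt-kan⋆)
      side″ (suc zero) true  = endLoopFill₁ (not s) (avar zero) a (wordAlong-end true v pt-kan⋆)

  loopWall : Fin N → Bool → Tm 2
  loopWall a b = if b then lp a (var zero) else pt

  loopWallSides : Fin N → Bool → Sides
  loopWallSides a b = if b then loopSides a else ⋆Sides

  loopWall-square : ∀ a b → KanSquare (loopWall a b) (loopWallSides a b)
  loopWall-square a false = pt-square
  loopWall-square a true  = loop-square a

  homotopySides : Word N → Word N → Sides
  homotopySides v w = sides (λ c → ⌜ if c then w else v ⌝) (λ _ → pt)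

  Homotopy : Word N → Word N → Set
  Homotopy v w = Σ (Tm 2) λ T → KanSquare T (homotopySides v w)

  boxHomotopy : ∀ e {X Y U FX FY FU} → (∀ c → KanSquare (X c) (FX c)) → (∀ b → KanSquare (Y b) (FY b)) → KanSquare U FU
              → (∀ c b → at₁ (FX c) b ≈ at₁ (FY b) c)
              → (∀ c → at₀ FU c ≈ at₀ (FX c) e) → (∀ b → at₁ FU b ≈ at₀ (FY b) e)
              → ∀ {v w} → (∀ x b → sideAt (boxSides e FX FY) x b ≈ sideAt (homotopySides v w) x b) → Homotopy v w
  boxHomotopy e {X} {Y} {U} X-sq Y-sq U-sq edge base₀ base₁ sides≈ =
    box e X Y U , KanSquare-resp (box-kanSquare e X-sq Y-sq U-sq edge base₀ base₁) sides≈

  homotopy-refl : ∀ v → Homotopy v v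
  homotopy-refl v = wordAlong (avar (suc zero)) pt v , KanSquare-resp (word-square (suc zero) v) sides≈
    where
    sides≈ : ∀ x b → sideAt (wordSides (suc zero) v) x b ≈ sideAt (homotopySides v v) x b
    sides≈ zero       false = ≈-refl
    sides≈ zero       true  = ≈-refl
    sides≈ (suc zero) b     = ≈-refl

  homotopy-euclidean : ∀ {u v w} → Homotopy u v → Homotopy u w → Homotopy v w
  homotopy-euclidean {u} {v} {w} (T₀ , T₀-sq) (T₁ , T₁-sq) =
    boxHomotopy false X-sq (λ _ → pt-square) (word-square (suc zero) u)
                (λ _ _ → ≈-refl) (λ _ → ≈-refl) (λ _ → ≈-refl) (λ _ _ → ≈-refl)
    where
    X : Bool → Tm 2
    X false = T₀
    X true  = T₁
    X-sq : ∀ c → KanSquare (X c) (homotopySides u (if c then w else v))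
    X-sq false = T₀-sq
    X-sq true  = T₁-sq

  homotopy-sym : ∀ {v w} → Homotopy v w → Homotopy w v
  homotopy-sym h = homotopy-euclidean h (homotopy-refl _)

  homotopy-trans : ∀ {u v w} → Homotopy u v → Homotopy v w → Homotopy u w
  homotopy-trans h₁ h₂ = homotopy-euclidean (homotopy-sym h₁) h₂

  homotopy-∷ʳ : ∀ {v w} → Homotopy v w → ∀ l → Homotopy (v ∷ʳ l) (w ∷ʳ l)
  homotopy-∷ʳ {v} {w} (T , T-sq) (a , s) =
    boxHomotopy (not s) (λ c → append-square a s (if c then w else v)) (loopWall-square a) T-sq edge (base₀ s) base₁ (sides≈ s)
    where
    edge : ∀ c b → at₁ (appendSides a s (if c then w else v)) b ≈ at₁ (loopWallSides a b) c
    edge c false = ≈-refl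
    edge c true  = ≈-refl
    base₀ : ∀ s c → ⌜ if c then w else v ⌝ ≈ at₀ (appendSides a s (if c then w else v)) (not s)
    base₀ false c = ≈-refl
    base₀ true  c = ≈-refl
    base₁ : ∀ b → pt ≈ at₀ (loopWallSides a b) (not s)
    base₁ false = ≈-refl
    base₁ true  = ≈-refl
    sides≈ : ∀ s x b → sideAt (boxSides (not s) (λ c → appendSides a s (if c then w else v)) (loopWallSides a)) x b
                       ≈ sideAt (homotopySides (v ∷ʳ (a , s)) (w ∷ʳ (a , s))) x b
    sides≈ false zero       false = ≈-refl
    sides≈ false zero       true  = ≈-refl
    sides≈ true  zero       false = ≈-refl
    sides≈ true  zero       true  = ≈-refl
    sides≈ s     (suc zero) false = ≈-refl
    sides≈ s     (suc zero) true  = ≈-refl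

  homotopy-++ : ∀ {v v′} → Homotopy v v′ → ∀ w → Homotopy (v ++ w) (v′ ++ w)
  homotopy-++ {v} {v′} h []      = subst₂ Homotopy (sym (++-identityʳ v)) (sym (++-identityʳ v′)) h
  homotopy-++ {v} {v′} h (l ∷ w) =
    subst₂ Homotopy (++-assoc v (l ∷ []) w) (++-assoc v′ (l ∷ []) w) (homotopy-++ (homotopy-∷ʳ h l) w)

  homotopy-cancel : ∀ u a s → Homotopy u (u ++ (a , s) ∷ (a , not s) ∷ [])
  homotopy-cancel u a s =
    boxHomotopy s (X-sq s) (loopWall-square a) (word-square (suc zero) (u ∷ʳ (a , s))) (edge s) (base₀ s) base₁ (sides≈ s)
    where
    FX : Bool → Bool → Sides
    FX s c = if c then appendSides a (not s) (u ∷ʳ (a , s)) else appendSides a s u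
    X-sq : ∀ s c → KanSquare (if c then appendSquare a (not s) (u ∷ʳ (a , s)) else appendSquare a s u) (FX s c)
    X-sq s false = append-square a s u
    X-sq s true  = append-square a (not s) (u ∷ʳ (a , s))
    edge : ∀ s c b → at₁ (FX s c) b ≈ at₁ (loopWallSides a b) c
    edge s false false = ≈-refl
    edge s false true  = ≈-refl
    edge s true  false = ≈-refl
    edge s true  true  = ≈-refl
    base₀ : ∀ s c → ⌜ u ∷ʳ (a , s) ⌝ ≈ at₀ (FX s c) s
    base₀ false false = ≈-refl
    base₀ false true  = ≈-refl
    base₀ true  false = ≈-refl
    base₀ true  true  = ≈-refl
    base₁ : ∀ b → pt ≈ at₀ (loopWallSides a b) s
    base₁ false = ≈-refl
    base₁ true  = ≈-refl
    sides≈ : ∀ s x b → sideAt (boxSides s (FX s) (loopWallSides a)) x b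
                       ≈ sideAt (homotopySides u (u ++ (a , s) ∷ (a , not s) ∷ [])) x b
    sides≈ false zero       false = ≈-refl
    sides≈ false zero       true  = ≈-reflexive (cong ⌜_⌝ (++-assoc u _ _))
    sides≈ true  zero       false = ≈-refl
    sides≈ true  zero       true  = ≈-reflexive (cong ⌜_⌝ (++-assoc u _ _))
    sides≈ s     (suc zero) false = ≈-refl
    sides≈ s     (suc zero) true  = ≈-refl

  homotopy-rel : ∀ u ρ → Homotopy u (u ++ (relA rel ρ , true) ∷ (relB rel ρ , true) ∷ (relC rel ρ , false) ∷ [])
  homotopy-rel u ρ = boxHomotopy true X-sq Y-sq (append-square B true (u ∷ʳ (A , true))) edge base₀ base₁ sides≈
    where
    A B C : Fin N
    A = relA rel ρ
    B = relB rel ρ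
    C = relC rel ρ
    FX : Bool → Sides
    FX c = if c then appendSides C false (u ++ (A , true) ∷ (B , true) ∷ []) else appendSides A true u
    X-sq : ∀ c → KanSquare (if c then appendSquare C false (u ++ (A , true) ∷ (B , true) ∷ []) else appendSquare A true u)
                           (FX c)
    X-sq false = append-square A true u
    X-sq true  = append-square C false (u ++ (A , true) ∷ (B , true) ∷ [])
    FY : Bool → Sides
    FY b = if b then relSides ρ else ⋆Sides
    Y-sq : ∀ b → KanSquare (if b then sq ρ (var zero) (var (suc zero)) else pt) (FY b)
    Y-sq false = pt-square
    Y-sq true  = rel-square ρ
    edge : ∀ c b → at₁ (FX c) b ≈ at₁ (FY b) c
    edge false false = ≈-refl
    edge false true  = ≈-refl
    edge true  false = ≈-refl
    edge true  true  = ≈-refl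
    base₀ : ∀ c → at₀ (appendSides B true (u ∷ʳ (A , true))) c ≈ at₀ (FX c) true
    base₀ false = ≈-refl
    base₀ true  = ≈-reflexive (cong ⌜_⌝ (++-assoc u _ _))
    base₁ : ∀ b → at₁ (appendSides B true (u ∷ʳ (A , true))) b ≈ at₀ (FY b) true
    base₁ false = ≈-refl
    base₁ true  = ≈-refl
    sides≈ : ∀ x b → sideAt (boxSides true FX FY) x b
                     ≈ sideAt (homotopySides u (u ++ (A , true) ∷ (B , true) ∷ (C , false) ∷ [])) x b
    sides≈ zero       false = ≈-refl
    sides≈ zero       true  = ≈-reflexive (cong ⌜_⌝ (++-assoc u _ _))
    sides≈ (suc zero) false = ≈-refl
    sides≈ (suc zero) true  = ≈-refl

  homotopy-delete : ∀ {r} → (∀ u → Homotopy u (u ++ r)) → ∀ u w → Homotopy (u ++ r ++ w) (u ++ w)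
  homotopy-delete {r} h u w = homotopy-sym (subst (Homotopy (u ++ w)) (++-assoc u r w) (homotopy-++ (h u) w))

  ≡G⇒Homotopy : ∀ {v w} → Group._≡G_ rel v w → Homotopy v w
  ≡G⇒Homotopy Group.G-refl           = homotopy-refl _
  ≡G⇒Homotopy (Group.G-sym p)        = homotopy-sym (≡G⇒Homotopy p)
  ≡G⇒Homotopy (Group.G-trans p q)    = homotopy-trans (≡G⇒Homotopy p) (≡G⇒Homotopy q)
  ≡G⇒Homotopy (Group.G-free u w a s) = homotopy-delete (λ u → homotopy-cancel u a s) u w
  ≡G⇒Homotopy (Group.G-rel u w ρ)    = homotopy-delete (λ u → homotopy-rel u ρ) u w

  transposedSides : Word N → Word N → Sides
  transposedSides v w = sides (λ _ → pt) (λ b → ⌜ if b then w else v ⌝)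

  transpose : ∀ {v w} → Homotopy v w → Σ (Tm 2) λ t → KanSquare t (transposedSides v w)
  transpose {v} {w} (T , T-sq) =
    box false (λ _ → pt) Y (wordAlong (avar zero) pt v) ,
    KanSquare-resp (box-kanSquare false (λ _ → pt-square) Y-sq (word-square zero v) edge (λ _ → ≈-refl) base₁) sides≈
    where
    Y : Bool → Tm 2
    Y b = if b then T else wordAlong (avar (suc zero)) pt v
    FY : Bool → Sides
    FY b = if b then homotopySides v w else wordSides (suc zero) v
    Y-sq : ∀ b → KanSquare (Y b) (FY b)
    Y-sq false = word-square (suc zero) v
    Y-sq true  = T-sq
    edge : ∀ c b → pt ≈ at₁ (FY b) c
    edge c false = ≈-refl
    edge c true  = ≈-refl
    base₁ : ∀ b → ⌜ v ⌝ ≈ at₀ (FY b) false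
    base₁ false = ≈-refl
    base₁ true  = ≈-refl
    sides≈ : ∀ x b → sideAt (boxSides false (λ _ → ⋆Sides) FY) x b ≈ sideAt (transposedSides v w) x b
    sides≈ zero       c     = ≈-refl
    sides≈ (suc zero) false = ≈-refl
    sides≈ (suc zero) true  = ≈-refl

proposition3p17 : (cls : Class) (N M : ℕ) (rel : Rel N M)
    → Group.ClosedUnderInverses rel
    → (v w : Word N) → Group._≡G_ rel v w
    → Σ (Cells.Tm cls rel 2) λ t →
        Cells.IsKan cls rel t
        × Cells.HasBdry cls rel t
            ( (avar zero Cells.≔ false ↦ Cells.pt)
            ∷ (avar zero Cells.≔ true ↦ Cells.pt)
            ∷ (avar (suc zero) Cells.≔ false ↦ Cells.⌜_⌝ cls rel v)
            ∷ (avar (suc zero) Cells.≔ true ↦ Cells.⌜_⌝ cls rel w)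
            ∷ [] )
proposition3p17 cls N M rel _ v w v≡w with KanSquares.transpose cls rel (KanSquares.≡G⇒Homotopy cls rel v≡w)
... | t , t-sq = t , kan , side zero false ∷ side zero true ∷ side (suc zero) false ∷ side (suc zero) true ∷ []
  where open KanSquares.KanSquare t-sq
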